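{- For each $i\in\{1,2,3,4\}$ and every positive integer $k$, $\mathrm{Bell}(k)\le f^i(k)\le 2^k\,\mathrm{Bell}(k)$.
   Context: All graphs are simple and labeled. $\mathrm{Bell}(k)$ is the number of partitions of a $k$-element labeled set. For a graph $G$, each connected component of the complement $\overline{G}$ has a vertex set $K$, and "$K$ induces in $G$" refers to $G[K]$. Define: $f^1(l)$ = number of graphs on $l$ labeled vertices each of whose complement-components induces in $G$ the disjoint union of a single vertex and a clique; $f^2(l)$ = number of graphs on $l$ labeled vertices each of whose complement-components induces in $G$ either a stable set of size three or the disjoint union of a vertex and a clique; $f^3(l)$ = number of graphs on $l$ labeled vertices each of whose complement-components induces in $G$ either a stable set or the disjoint union of a vertex and a clique; $f^4(l)$ = number of graphs on $l$ labeled vertices each of whose complement-components induces in $G$ the disjoint union of a stable set and a clique. -}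

module Defs where

open import Data.Nat using (ℕ; zero; suc; _≡ᵇ_)
open import Data.Bool using (Bool; true; false; _∧_; _∨_; not; if_then_else_)
open import Data.Fin using (Fin; zero; suc)
open import Data.Fin.Properties using (_≟_)
open import Data.List using (List; []; _∷_; [_]; map; concatMap; length; filterᵇ; allFin)
open import Data.Bool.ListAction using (all; any)
open import Relation.Nullary.Decidable using (⌊_⌋)

extend : ∀ {A : Set} {m : ℕ} → A → (Fin m → A) → Fin (suc m) → A
extend a f zero    = a
extend a f (suc i) = f i

allFunsTo : ∀ {A : Set} → List A → (m : ℕ) → List (Fin m → A)
allFunsTo xs zero    = [ (λ ()) ]
allFunsTo xs (suc m) = concatMap (λ a → map (extend a) (allFunsTo xs m)) xs

bools : List Bool
bools = true ∷ false ∷ []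

Subset : ℕ → Set
Subset n = Fin n → Bool

allSubsets : (n : ℕ) → List (Subset n)
allSubsets n = allFunsTo bools n

Rel : ℕ → Set
Rel n = Fin n → Fin n → Bool

allRels : (n : ℕ) → List (Rel n)
allRels n = allFunsTo (allSubsets n) n

vs : (n : ℕ) → List (Fin n)
vs n = allFin n

_==_ : ∀ {n} → Fin n → Fin n → Bool
u == v = ⌊ u ≟ v ⌋

_⇒ᵇ_ : Bool → Bool → Bool
a ⇒ᵇ b = not a ∨ b

_⇔ᵇ_ : Bool → Bool → Bool
a ⇔ᵇ b = (a ⇒ᵇ b) ∧ (b ⇒ᵇ a)

countᵇ : ∀ {A : Set} → (A → Bool) → List A → ℕ
countᵇ p xs = length (filterᵇ p xs)

-- Bell numbers: number of partitions of a k-element set,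
-- i.e. number of equivalence relations on Fin k.

isEquivRel : ∀ {n} → Rel n → Bool
isEquivRel {n} r =
  all (λ u → r u u) (vs n) ∧
  all (λ u → all (λ v → r u v ⇒ᵇ r v u) (vs n)) (vs n) ∧
  all (λ u → all (λ v → all (λ w → (r u v ∧ r v w) ⇒ᵇ r u w) (vs n)) (vs n)) (vs n)

Bell : ℕ → ℕ
Bell k = countᵇ isEquivRel (allRels k)

Graph : ℕ → Set
Graph n = Rel n

isSimple : ∀ {n} → Graph n → Bool
isSimple {n} g =
  all (λ u → not (g u u)) (vs n) ∧
  all (λ u → all (λ v → g u v ⇔ᵇ g v u) (vs n)) (vs n)

coAdj : ∀ {n} → Graph n → Fin n → Fin n → Bool
coAdj g u v = not (u == v) ∧ not (g u v)

walkᶜ : ∀ {n} → Graph n → ℕ → Fin n → Fin n → Bool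
walkᶜ g zero    u v = u == v
walkᶜ {n} g (suc t) u v =
  walkᶜ g t u v ∨ any (λ w → walkᶜ g t u w ∧ coAdj g w v) (vs n)

-- u and v lie in the same connected component of the complement
-- (on n vertices, walks of length ≤ n suffice)
sameCompᶜ : ∀ {n} → Graph n → Fin n → Fin n → Bool
sameCompᶜ {n} g u v = walkᶜ g n u v

compᶜ : ∀ {n} → Graph n → Fin n → Subset n
compᶜ g v = sameCompᶜ g v

allPairs : ∀ {n} → Subset n → (Fin n → Fin n → Bool) → Bool
allPairs {n} K P =
  all (λ u → all (λ w → (K u ∧ K w ∧ not (u == w)) ⇒ᵇ P u w) (vs n)) (vs n)

-- G[K] is the disjoint union of a single vertex x and a clique (possibly empty):
-- some x ∈ K, and distinct u,w ∈ K are adjacent iff neither is x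
vertexPlusClique : ∀ {n} → Graph n → Subset n → Bool
vertexPlusClique {n} g K =
  any (λ x → K x ∧ allPairs K (λ u w → g u w ⇔ᵇ (not (u == x) ∧ not (w == x)))) (vs n)

stableSet : ∀ {n} → Graph n → Subset n → Bool
stableSet g K = allPairs K (λ u w → not (g u w))

stable3 : ∀ {n} → Graph n → Subset n → Bool
stable3 {n} g K = stableSet g K ∧ (countᵇ K (vs n) ≡ᵇ 3)

-- G[K] is the disjoint union of a stable set S and a clique C (either may be empty):
-- for some subset S, with C = K \ S, distinct u,w ∈ K are adjacent iff both lie in C
stablePlusClique : ∀ {n} → Graph n → Subset n → Bool
stablePlusClique {n} g K =
  any (λ S → allPairs K (λ u w → g u w ⇔ᵇ (not (S u) ∧ not (S w)))) (allSubsets n)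

everyCompᶜ : ∀ {n} → (Graph n → Subset n → Bool) → Graph n → Bool
everyCompᶜ {n} shape g = all (λ v → shape g (compᶜ g v)) (vs n)

numGraphs : (n : ℕ) → (Graph n → Subset n → Bool) → ℕ
numGraphs n shape = countᵇ (λ g → isSimple g ∧ everyCompᶜ shape g) (allRels n)

f¹ : ℕ → ℕ
f¹ l = numGraphs l vertexPlusClique

f² : ℕ → ℕ
f² l = numGraphs l (λ g K → stable3 g K ∨ vertexPlusClique g K)

f³ : ℕ → ℕ
f³ l = numGraphs l (λ g K → stableSet g K ∨ vertexPlusClique g K)

f⁴ : ℕ → ℕ
f⁴ l = numGraphs l stablePlusClique

-- Every shape allowed by f¹, f², f³ is a stable set plus a clique, so f¹ ≤ fⁱ ≤ f⁴.
-- A graph counted by f⁴ is adjacent across different components of its complement and,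
-- inside a component K, is a stable set S ∩ K plus a clique K ∖ S; it is therefore
-- determined by the partition into complement components and the set S, whence
-- f⁴ ≤ 2^k Bell(k). Conversely, choosing a representative in every block of a partition
-- and making the rest of the block a clique gives a graph counted by f¹ whose complement
-- components (stars around the representatives) are the blocks; so taking complement
-- components maps the f¹-graphs onto the partitions, and Bell(k) ≤ f¹.
module Submission where

open import Level using (0ℓ)
open import Data.Nat using (ℕ; zero; suc; _≤_; _<_; _≤′_; ≤′-refl; ≤′-step; _+_; _*_; _^_; z≤n; s≤s)
open import Data.Nat.Properties
  using (≤-trans; ≤-reflexive; <-irrefl; <⇒≤; ≤⇒≤′; m≤n⇒m≤1+n; m<n⇒m<1+n; m≤m+n; *-comm; n<1+n; module ≤-Reasoning)
open import Data.Bool using (Bool; true; false; T; not; _∧_; _∨_; if_then_else_)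
open import Data.Bool.ListAction using (all; any; and; or)
open import Data.Bool.Properties using (T-≡; T-∧; T-∨; T-not-≡; ∧-comm; ∧-zeroʳ)
open import Data.Fin using (Fin; zero; suc)
open import Data.Fin.Properties using (_≟_)
open import Data.List using (List; []; _∷_; _++_; map; concatMap; length; filterᵇ; cartesianProductWith)
open import Data.List.Properties
  using (length-++; length-map; length-filter; length-removeAt′; length-tabulate; map-cong)
open import Data.List.Relation.Unary.Any as Any using (here; there)
open import Data.List.Relation.Unary.Any.Properties using (any⁺; any⁻)
open import Data.List.Relation.Unary.All as All using (All; []; _∷_)
open import Data.List.Relation.Unary.All.Properties using (all⁺; all⁻; all-filter; tabulate⁺; ¬All⇒Any¬)
open import Data.List.Relation.Unary.AllPairs using ([]; _∷_)
open import Data.List.Relation.Unary.Unique.Setoid using (Unique)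
open import Data.List.Relation.Unary.Unique.Setoid.Properties using (cartesianProductWith⁺; filter⁺)
import Data.List.Membership.Setoid as Membership
open Membership using () renaming (_∈_ to [_]_∈_)
open import Data.List.Membership.Setoid.Properties using (∈-resp-≈; ∈-map⁺; ∈-cartesianProductWith⁺; ∈-filter⁺)
open import Data.List.Membership.Propositional using () renaming (_∈_ to _∈ₚ_)
open import Data.List.Membership.Propositional.Properties using (∈-allFin)
import Data.List.Relation.Binary.Sublist.Propositional as Sublist
import Data.List.Relation.Binary.Sublist.Propositional.Properties as Sublist
open import Data.Product as Product using (_×_; _,_; proj₁; proj₂; ∃-syntax; uncurry)
open import Data.Sum using (_⊎_; inj₁; inj₂; [_,_]′)
open import Function using (_∘_; id)
open import Function.Bundles using (_⇔_; mk⇔; module Equivalence)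
open import Function.Indexed.Relation.Binary.Equality using (≡-setoid)
open import Relation.Binary.Bundles using (Setoid)
open import Relation.Binary.Structures using (IsEquivalence)
import Relation.Binary.Indexed.Heterogeneous.Construct.Trivial as Trivial
open import Relation.Binary.Construct.Closure.ReflexiveTransitive as Star using (Star; ε; _◅◅_; return)
open import Relation.Binary.PropositionalEquality
  using (_≡_; _≢_; refl; sym; trans; cong; cong₂; subst; setoid; module ≡-Reasoning)
open import Relation.Nullary using (¬_; contradiction; yes; no)
open import Relation.Nullary.Decidable using (T?; toWitness; fromWitness; toWitnessFalse; fromWitnessFalse)

open import Defs

open Equivalence using (to; from)

module _ {a ℓ} (S : Setoid a ℓ) where
  open Setoid S using (_≈_) renaming (sym to ≈-sym; trans to ≈-trans)
  open Membership S using (_∈_; _─_)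

  ∈-─ : ∀ {x y ys} (x∈ys : x ∈ ys) → y ∈ ys → ¬ x ≈ y → y ∈ ys ─ x∈ys
  ∈-─ (here x≈z)   (here y≈z)   x≉y = contradiction (≈-trans x≈z (≈-sym y≈z)) x≉y
  ∈-─ (here _)     (there y∈ys) _   = y∈ys
  ∈-─ (there _)    (here y≈z)   _   = here y≈z
  ∈-─ (there x∈ys) (there y∈ys) x≉y = there (∈-─ x∈ys y∈ys x≉y)

  unique-length-≤ : ∀ {xs ys} → Unique S xs → All (_∈ ys) xs → length xs ≤ length ys
  unique-length-≤ [] [] = z≤n
  unique-length-≤ {ys = ys} (x≉xs ∷ xs!) (x∈ys ∷ xs⊆ys) =
    ≤-trans (s≤s (unique-length-≤ xs! (All.zipWith (λ (x≉y , y∈ys) → ∈-─ x∈ys y∈ys x≉y) (x≉xs , xs⊆ys))))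
            (≤-reflexive (sym (length-removeAt′ ys (Any.index x∈ys))))

module _ {A B C : Set} (f : A → B → C) where

  concatMap-map≡cartesianProductWith : ∀ xs ys → concatMap (λ x → map (f x) ys) xs ≡ cartesianProductWith f xs ys
  concatMap-map≡cartesianProductWith []       ys = refl
  concatMap-map≡cartesianProductWith (x ∷ xs) ys = cong (map (f x) ys ++_) (concatMap-map≡cartesianProductWith xs ys)

  length-cartesianProductWith : ∀ xs ys → length (cartesianProductWith f xs ys) ≡ length xs * length ys
  length-cartesianProductWith []       ys = refl
  length-cartesianProductWith (x ∷ xs) ys = begin
    length (map (f x) ys ++ cartesianProductWith f xs ys)          ≡⟨ length-++ (map (f x) ys) ⟩
    length (map (f x) ys) + length (cartesianProductWith f xs ys) ≡⟨ cong₂ _+_ (length-map (f x) ys)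
                                                                       (length-cartesianProductWith xs ys) ⟩
    length ys + length xs * length ys                              ∎
    where open ≡-Reasoning

module _ {A : Set} {p q : A → Bool} (p⇒q : ∀ {x} → T (p x) → T (q x)) where

  countᵇ-mono : ∀ xs → countᵇ p xs ≤ countᵇ q xs
  countᵇ-mono xs =
    Sublist.length-mono-≤ (Sublist.filter⁺ (T? ∘ p) (T? ∘ q) (λ { refl → p⇒q }) (Sublist.⊆-refl {x = xs}))

  countᵇ-mono-< : ∀ {x xs} → x ∈ₚ xs → ¬ T (p x) → T (q x) → countᵇ p xs < countᵇ q xs
  countᵇ-mono-< {xs = y ∷ ys} (here refl) ¬py qy with p y | q y
  ... | true  | _     = contradiction _ ¬py
  ... | false | true  = s≤s (countᵇ-mono ys)
  ... | false | false = contradiction qy λ ()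
  countᵇ-mono-< {xs = y ∷ ys} (there x∈ys) ¬px qx with p y | q y | p⇒q {y}
  ... | true  | true  | _   = s≤s (countᵇ-mono-< x∈ys ¬px qx)
  ... | true  | false | py⇒qy = contradiction (py⇒qy _) λ ()
  ... | false | true  | _   = m≤n⇒m≤1+n (countᵇ-mono-< x∈ys ¬px qx)
  ... | false | false | _   = countᵇ-mono-< x∈ys ¬px qx

-- Without function extensionality, lists of functions can only be duplicate-free and
-- complete up to pointwise equality.
infixr 4 _⇨_
_⇨_ : ∀ {a ℓ} → ℕ → Setoid a ℓ → Setoid a ℓ
m ⇨ S = ≡-setoid (Fin m) (Trivial.indexedSetoid S)

module _ {ℓ} (S : Setoid 0ℓ ℓ) where
  open Setoid S using (_≈_) renaming (Carrier to A; refl to ≈-refl)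
  open Membership S using (_∈_)

  extend-cong : ∀ {m a b} {f h : Fin m → A} → a ≈ b → (∀ i → f i ≈ h i) → ∀ i → extend a f i ≈ extend b h i
  extend-cong a≈b f≈h zero    = a≈b
  extend-cong a≈b f≈h (suc i) = f≈h i

  allFunsTo-complete : ∀ {xs} → (∀ a → a ∈ xs) → ∀ m (f : Fin m → A) → [ m ⇨ S ] f ∈ allFunsTo xs m
  allFunsTo-complete xs-complete zero    f = here (λ ())
  allFunsTo-complete {xs} xs-complete (suc m) f =
    subst ([ suc m ⇨ S ] f ∈_) (sym (concatMap-map≡cartesianProductWith extend xs (allFunsTo xs m)))
      (∈-resp-≈ (suc m ⇨ S) (λ { zero → ≈-refl ; (suc i) → ≈-refl })
        (∈-cartesianProductWith⁺ S (m ⇨ S) (suc m ⇨ S) extend-cong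
          (xs-complete (f zero)) (allFunsTo-complete xs-complete m (f ∘ suc))))

  allFunsTo-unique : ∀ {xs} → Unique S xs → ∀ m → Unique (m ⇨ S) (allFunsTo xs m)
  allFunsTo-unique xs! zero    = [] ∷ []
  allFunsTo-unique {xs} xs! (suc m) =
    subst (Unique (suc m ⇨ S)) (sym (concatMap-map≡cartesianProductWith extend xs (allFunsTo xs m)))
      (cartesianProductWith⁺ S (m ⇨ S) (suc m ⇨ S) extend (λ eq → eq zero , eq ∘ suc)
        xs! (allFunsTo-unique xs! m))

length-allFunsTo : ∀ {A : Set} (xs : List A) m → length (allFunsTo xs m) ≡ length xs ^ m
length-allFunsTo xs zero    = refl
length-allFunsTo xs (suc m) = begin
  length (concatMap (λ a → map (extend a) (allFunsTo xs m)) xs) ≡⟨ cong length (concatMap-map≡cartesianProductWith extend xs _) ⟩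
  length (cartesianProductWith extend xs (allFunsTo xs m))     ≡⟨ length-cartesianProductWith extend xs _ ⟩
  length xs * length (allFunsTo xs m)                          ≡⟨ cong (length xs *_) (length-allFunsTo xs m) ⟩
  length xs * length xs ^ m                                    ∎
  where open ≡-Reasoning

subsetSetoid : ℕ → Setoid 0ℓ 0ℓ
subsetSetoid n = n ⇨ setoid Bool

relSetoid : ℕ → Setoid 0ℓ 0ℓ
relSetoid n = n ⇨ subsetSetoid n

infix 4 _≋_
_≋_ : ∀ {n} → Rel n → Rel n → Set
r ≋ s = ∀ u v → r u v ≡ s u v

bools-complete : ∀ b → [ setoid Bool ] b ∈ bools
bools-complete true  = here refl
bools-complete false = there (here refl)

subset-∈-allSubsets : ∀ {n} (S : Subset n) → [ subsetSetoid n ] S ∈ allSubsets n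
subset-∈-allSubsets {n} = allFunsTo-complete (setoid Bool) bools-complete n

rel-∈-allRels : ∀ {n} (r : Rel n) → [ relSetoid n ] r ∈ allRels n
rel-∈-allRels {n} = allFunsTo-complete (subsetSetoid n) subset-∈-allSubsets n

allRels-unique : ∀ n → Unique (relSetoid n) (allRels n)
allRels-unique n = allFunsTo-unique (subsetSetoid n) (allFunsTo-unique (setoid Bool) bools-unique n) n
  where
  bools-unique : Unique (setoid Bool) bools
  bools-unique = ((λ ()) ∷ []) ∷ [] ∷ []

T-⇒ᵇ⁻ : ∀ {a b} → T (a ⇒ᵇ b) → T a → T b
T-⇒ᵇ⁻ {true} h _ = h

T-⇒ᵇ⁺ : ∀ {a b} → (T a → T b) → T (a ⇒ᵇ b)
T-⇒ᵇ⁺ {true}  h = h _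
T-⇒ᵇ⁺ {false} h = _

T-⇔ᵇ⁻ : ∀ {a b} → T (a ⇔ᵇ b) → a ≡ b
T-⇔ᵇ⁻ {true}  {true}  _ = refl
T-⇔ᵇ⁻ {false} {false} _ = refl

T-⇔ᵇ⁺ : ∀ {a b} → a ≡ b → T (a ⇔ᵇ b)
T-⇔ᵇ⁺ {true}  refl = _
T-⇔ᵇ⁺ {false} refl = _

T-⇒ᵇ-counterexample : ∀ {a b} → ¬ T (a ⇒ᵇ b) → T a × ¬ T b
T-⇒ᵇ-counterexample {true}  {false} _ = _ , λ ()
T-⇒ᵇ-counterexample {true}  {true}  h = contradiction _ h
T-⇒ᵇ-counterexample {false}         h = contradiction _ h

T-injective : ∀ {a b} → (T a → T b) → (T b → T a) → a ≡ b
T-injective {false} {false} _   _   = refl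
T-injective {false} {true}  _   b⇒a = contradiction (b⇒a _) λ ()
T-injective {true}  {false} a⇒b _   = contradiction (a⇒b _) λ ()
T-injective {true}  {true}  _   _   = refl

==⇒≡ : ∀ {n} {u v : Fin n} → T (u == v) → u ≡ v
==⇒≡ {u = u} {v} = toWitness {a? = u ≟ v}

≡⇒== : ∀ {n} {u v : Fin n} → u ≡ v → T (u == v)
≡⇒== {u = u} {v} = fromWitness {a? = u ≟ v}

==-sym : ∀ {n} (u v : Fin n) → (u == v) ≡ (v == u)
==-sym u v = T-injective (≡⇒== ∘ sym ∘ ==⇒≡) (≡⇒== ∘ sym ∘ ==⇒≡)

⟦_⟧ : ∀ {n} → Rel n → Fin n → Fin n → Set
⟦ r ⟧ u v = T (r u v)

module _ {n} {p : Fin n → Bool} where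

  all-vs⁻ : T (all p (vs n)) → ∀ v → T (p v)
  all-vs⁻ h v = All.lookup (all⁺ p (vs n) h) (∈-allFin v)

  all-vs⁺ : (∀ v → T (p v)) → T (all p (vs n))
  all-vs⁺ h = all⁻ p (tabulate⁺ h)

  any-vs⁻ : T (any p (vs n)) → ∃[ v ] T (p v)
  any-vs⁻ h = Any.satisfied (any⁻ p (vs n) h)

  any-vs⁺ : ∀ v → T (p v) → T (any p (vs n))
  any-vs⁺ v h = any⁺ p (Any.map (λ { refl → h }) (∈-allFin v))

module _ {n} {K : Subset n} {P : Fin n → Fin n → Bool} where

  allPairs⁻ : T (allPairs K P) → ∀ {u w} → T (K u) → T (K w) → u ≢ w → T (P u w)
  allPairs⁻ h {u} {w} Ku Kw u≢w =
    T-⇒ᵇ⁻ (all-vs⁻ (all-vs⁻ h u) w) (from T-∧ (Ku , from T-∧ (Kw , fromWitnessFalse u≢w)))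

  allPairs⁺ : (∀ {u w} → T (K u) → T (K w) → u ≢ w → T (P u w)) → T (allPairs K P)
  allPairs⁺ h = all-vs⁺ λ u → all-vs⁺ λ w → T-⇒ᵇ⁺ (distinct-members u w)
    where
    distinct-members : ∀ u w → T (K u ∧ K w ∧ not (u == w)) → T (P u w)
    distinct-members u w Ku∧Kw∧u≢w with Ku , Kw∧u≢w ← to T-∧ Ku∧Kw∧u≢w
                                    with Kw , u≢w ← to (T-∧ {K w}) Kw∧u≢w
      = h Ku Kw (toWitnessFalse u≢w)

module _ {n} {g : Graph n} where

  isSimple⁻ : T (isSimple g) → (∀ u → g u u ≡ false) × (∀ u v → g u v ≡ g v u)
  isSimple⁻ h with irreflexive , symmetric ← to T-∧ h =
    (λ u → to T-not-≡ (all-vs⁻ irreflexive u)) , (λ u v → T-⇔ᵇ⁻ (all-vs⁻ (all-vs⁻ symmetric u) v))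

  isSimple⁺ : (∀ u → g u u ≡ false) → (∀ u v → g u v ≡ g v u) → T (isSimple g)
  isSimple⁺ irreflexive symmetric = from T-∧
    ( all-vs⁺ (λ u → from T-not-≡ (irreflexive u))
    , all-vs⁺ (λ u → all-vs⁺ λ v → T-⇔ᵇ⁺ (symmetric u v)) )

module _ {n} {r : Rel n} where

  isEquivRel⁻ : T (isEquivRel r) → IsEquivalence ⟦ r ⟧
  isEquivRel⁻ h
    with reflexive , h′ ← to T-∧ h
    with symmetric , transitive ← to (T-∧ {all (λ u → all (λ v → r u v ⇒ᵇ r v u) (vs n)) (vs n)}) h′ = record
    { refl  = λ {u} → all-vs⁻ reflexive u
    ; sym   = λ {u} {v} → T-⇒ᵇ⁻ (all-vs⁻ (all-vs⁻ symmetric u) v)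
    ; trans = λ {u} {v} {w} ruv rvw →
        T-⇒ᵇ⁻ (all-vs⁻ (all-vs⁻ (all-vs⁻ transitive u) v) w) (from T-∧ (ruv , rvw))
    }

  isEquivRel⁺ : IsEquivalence ⟦ r ⟧ → T (isEquivRel r)
  isEquivRel⁺ r-equiv = from T-∧
    ( all-vs⁺ (λ u → R.refl {u})
    , from T-∧ ( all-vs⁺ (λ u → all-vs⁺ λ v → T-⇒ᵇ⁺ (R.sym {u} {v}))
               , all-vs⁺ (λ u → all-vs⁺ λ v → all-vs⁺ λ w → T-⇒ᵇ⁺ (uncurry (R.trans {u} {v} {w}) ∘ to T-∧)) ) )
    where module R = IsEquivalence r-equiv

Shape : ℕ → Set
Shape n = Graph n → Subset n → Bool

qualifies : ∀ {n} → Shape n → Graph n → Bool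
qualifies shape g = isSimple g ∧ everyCompᶜ shape g

module _ {A : Set} {p q : A → Bool} (p≗q : ∀ x → p x ≡ q x) where

  all-cong : ∀ xs → all p xs ≡ all q xs
  all-cong xs = cong and (map-cong p≗q xs)

  any-cong : ∀ xs → any p xs ≡ any q xs
  any-cong xs = cong or (map-cong p≗q xs)

isEquivRel-cong : ∀ {n} {r s : Rel n} → r ≋ s → isEquivRel r ≡ isEquivRel s
isEquivRel-cong {n} r≋s = cong₂ _∧_
  (all-cong (λ u → r≋s u u) (vs n))
  (cong₂ _∧_ (all-cong (λ u → all-cong (λ v → cong₂ _⇒ᵇ_ (r≋s u v) (r≋s v u)) (vs n)) (vs n))
             (all-cong (λ u → all-cong (λ v → all-cong (λ w →
               cong₂ _⇒ᵇ_ (cong₂ _∧_ (r≋s u v) (r≋s v w)) (r≋s u w)) (vs n)) (vs n)) (vs n)))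

isSimple-cong : ∀ {n} {g h : Graph n} → g ≋ h → isSimple g ≡ isSimple h
isSimple-cong {n} g≋h = cong₂ _∧_
  (all-cong (λ u → cong not (g≋h u u)) (vs n))
  (all-cong (λ u → all-cong (λ v → cong₂ _⇔ᵇ_ (g≋h u v) (g≋h v u)) (vs n)) (vs n))

walkᶜ-cong : ∀ {n} {g h : Graph n} → g ≋ h → ∀ t u v → walkᶜ g t u v ≡ walkᶜ h t u v
walkᶜ-cong g≋h zero    u v = refl
walkᶜ-cong {n} g≋h (suc t) u v = cong₂ _∨_ (walkᶜ-cong g≋h t u v) (any-cong (λ w →
  cong₂ _∧_ (walkᶜ-cong g≋h t u w) (cong (λ b → not (w == v) ∧ not b) (g≋h w v))) (vs n))

allPairs-cong : ∀ {n} {K L : Subset n} {P Q : Rel n} → (∀ u → K u ≡ L u) → P ≋ Q → allPairs K P ≡ allPairs L Q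
allPairs-cong {n} K≗L P≋Q = all-cong (λ u → all-cong (λ w →
  cong₂ _⇒ᵇ_ (cong₂ _∧_ (K≗L u) (cong₂ _∧_ (K≗L w) refl)) (P≋Q u w)) (vs n)) (vs n)

vertexPlusClique-cong : ∀ {n} {g h : Graph n} {K L : Subset n} → g ≋ h → (∀ u → K u ≡ L u) →
                        vertexPlusClique g K ≡ vertexPlusClique h L
vertexPlusClique-cong {n} g≋h K≗L = any-cong (λ x →
  cong₂ _∧_ (K≗L x) (allPairs-cong K≗L (λ u w → cong (_⇔ᵇ _) (g≋h u w)))) (vs n)

qualifies-vertexPlusClique-cong : ∀ {n} {g h : Graph n} → g ≋ h →
                                  qualifies vertexPlusClique g ≡ qualifies vertexPlusClique h
qualifies-vertexPlusClique-cong {n} g≋h = cong₂ _∧_ (isSimple-cong g≋h)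
  (all-cong (λ v → vertexPlusClique-cong g≋h (walkᶜ-cong g≋h n v)) (vs n))

module _ {n} {g : Graph n} where

  walkᶜ-suc : ∀ t {u v} → T (walkᶜ g t u v) → T (walkᶜ g (suc t) u v)
  walkᶜ-suc t = from T-∨ ∘ inj₁

  walkᶜ-snoc : ∀ t {u w v} → T (walkᶜ g t u w) → T (coAdj g w v) → T (walkᶜ g (suc t) u v)
  walkᶜ-snoc t {w = w} uw wv = from T-∨ (inj₂ (any-vs⁺ w (from T-∧ (uw , wv))))

  walkᶜ-suc⁻ : ∀ t {u v} → T (walkᶜ g (suc t) u v) →
               T (walkᶜ g t u v) ⊎ ∃[ w ] T (walkᶜ g t u w) × T (coAdj g w v)
  walkᶜ-suc⁻ t {u} h with to (T-∨ {walkᶜ g t u _}) h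
  ... | inj₁ uv = inj₁ uv
  ... | inj₂ ∃w with w , uw∧wv ← any-vs⁻ ∃w = inj₂ (w , to T-∧ uw∧wv)

  walkᶜ-mono : ∀ {t t′ u v} → t ≤ t′ → T (walkᶜ g t u v) → T (walkᶜ g t′ u v)
  walkᶜ-mono = go ∘ ≤⇒≤′
    where
    go : ∀ {t t′ u v} → t ≤′ t′ → T (walkᶜ g t u v) → T (walkᶜ g t′ u v)
    go ≤′-refl                h = h
    go (≤′-step {t′} t≤t′) h = walkᶜ-suc t′ (go t≤t′ h)

  walkᶜ⇒Star : ∀ t {u v} → T (walkᶜ g t u v) → Star ⟦ coAdj g ⟧ u v
  walkᶜ⇒Star zero    uv with refl ← ==⇒≡ uv = ε
  walkᶜ⇒Star (suc t) uv with walkᶜ-suc⁻ t uv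
  ... | inj₁ uv′            = walkᶜ⇒Star t uv′
  ... | inj₂ (w , uw , wv) = walkᶜ⇒Star t uw ◅◅ return wv

  Star⇒walkᶜ : ∀ {u v} → Star ⟦ coAdj g ⟧ u v → ∃[ t ] T (walkᶜ g t u v)
  Star⇒walkᶜ = Star.foldl (λ u v → ∃[ t ] T (walkᶜ g t u v))
    (λ (t , uw) wv → suc t , walkᶜ-snoc t uw wv) (0 , ≡⇒== refl)

-- The vertices reached from u by complement walks of length ≤ t increase with t; once they
-- stop increasing they stay fixed, and they can increase fewer than n times. So walks of
-- length n, the bound used by sameCompᶜ, reach the whole component.
module Saturation {n} (g : Graph n) (u : Fin n) where

  Closed : ℕ → Set
  Closed t = ∀ {v} → T (walkᶜ g (suc t) u v) → T (walkᶜ g t u v)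

  closed-+ : ∀ {t} → Closed t → ∀ s → Closed (s + t)
  closed-+ closed zero = closed
  closed-+ closed (suc s) {v} h with walkᶜ-suc⁻ (suc s + _) h
  ... | inj₁ h′            = h′
  ... | inj₂ (w , uw , wv) = walkᶜ-snoc (s + _) (closed-+ closed s uw) wv

  closed-absorbs : ∀ {t} → Closed t → ∀ s {v} → T (walkᶜ g (s + t) u v) → T (walkᶜ g t u v)
  closed-absorbs closed zero    h = h
  closed-absorbs closed (suc s) h = closed-absorbs closed s (closed-+ closed s h)

  closed-or-new : ∀ t → Closed t ⊎ ∃[ v ] T (walkᶜ g (suc t) u v) × ¬ T (walkᶜ g t u v)
  closed-or-new t with T? (all (λ v → walkᶜ g (suc t) u v ⇒ᵇ walkᶜ g t u v) (vs n))
  ... | yes closed = inj₁ (λ {v} → T-⇒ᵇ⁻ (all-vs⁻ closed v))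
  ... | no ¬closed = inj₂ (Product.map₂ T-⇒ᵇ-counterexample
                             (Any.satisfied (¬All⇒Any¬ (T? ∘ _) (vs n) (¬closed ∘ all⁻ _))))

  reached : ℕ → ℕ
  reached t = countᵇ (walkᶜ g t u) (vs n)

  closed-or-grows : ∀ t → (∃[ s ] s < t × Closed s) ⊎ t < reached t
  closed-or-grows zero =
    inj₂ (≤-trans (s≤s z≤n) (countᵇ-mono-< {p = λ _ → false} (λ ()) (∈-allFin u) (λ ()) (≡⇒== refl)))
  closed-or-grows (suc t) with closed-or-grows t | closed-or-new t
  ... | inj₁ (s , s<t , closed) | _          = inj₁ (s , m<n⇒m<1+n s<t , closed)
  ... | inj₂ _                  | inj₁ closed = inj₁ (t , n<1+n t , closed)
  ... | inj₂ t<reached          | inj₂ (v , new , ¬old) =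
    inj₂ (≤-trans (s≤s t<reached) (countᵇ-mono-< (walkᶜ-suc t) (∈-allFin v) ¬old new))

  closed-below-n : ∃[ s ] s < n × Closed s
  closed-below-n with closed-or-grows n
  ... | inj₁ closed    = closed
  ... | inj₂ n<reached = contradiction (≤-trans n<reached reached≤n) (<-irrefl refl)
    where
    reached≤n : reached n ≤ n
    reached≤n = ≤-trans (length-filter _ (vs n)) (≤-reflexive (length-tabulate _))

  walkᶜ⇒sameCompᶜ : ∀ t {v} → T (walkᶜ g t u v) → T (sameCompᶜ g u v)
  walkᶜ⇒sameCompᶜ t h with s , s<n , closed ← closed-below-n =
    walkᶜ-mono (<⇒≤ s<n) (closed-absorbs closed t (walkᶜ-mono (m≤m+n t s) h))

sameCompᶜ⇔Star : ∀ {n} {g : Graph n} {u v} → T (sameCompᶜ g u v) ⇔ Star ⟦ coAdj g ⟧ u v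
sameCompᶜ⇔Star {n} {g} {u} = mk⇔ (walkᶜ⇒Star n) λ uv →
  let t , walk = Star⇒walkᶜ uv in Saturation.walkᶜ⇒sameCompᶜ g u t walk

module _ {n} {g : Graph n} where

  coAdj-sym : (∀ u v → g u v ≡ g v u) → ∀ {u v} → T (coAdj g u v) → T (coAdj g v u)
  coAdj-sym g-sym {u} {v} uv with u≢v , ¬guv ← to (T-∧ {not (u == v)}) uv =
    from T-∧ (fromWitnessFalse (toWitnessFalse {a? = u ≟ v} u≢v ∘ sym) , subst (T ∘ not) (g-sym u v) ¬guv)

  sameCompᶜ-isEquivalence : (∀ u v → g u v ≡ g v u) → IsEquivalence ⟦ sameCompᶜ g ⟧
  sameCompᶜ-isEquivalence g-sym = record
    { refl  = from comp⇔ ε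
    ; sym   = from comp⇔ ∘ Star.reverse (coAdj-sym g-sym) ∘ to comp⇔
    ; trans = λ uv vw → from comp⇔ (to comp⇔ uv ◅◅ to comp⇔ vw)
    }
    where
    comp⇔ : ∀ {u v} → T (sameCompᶜ g u v) ⇔ Star ⟦ coAdj g ⟧ u v
    comp⇔ = sameCompᶜ⇔Star

  coAdj⇒sameCompᶜ : ∀ {u v} → T (coAdj g u v) → T (sameCompᶜ g u v)
  coAdj⇒sameCompᶜ = from (sameCompᶜ⇔Star {g = g}) ∘ return

sameCompᶜ-cong : ∀ {n} {g h : Graph n} → g ≋ h → sameCompᶜ g ≋ sameCompᶜ h
sameCompᶜ-cong {n} g≋h = walkᶜ-cong g≋h n

pick : ∀ {A : Set} → (A → Bool) → A → List A → A
pick p d []       = d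
pick p d (x ∷ xs) = if p x then x else pick p d xs

module _ {A : Set} {p : A → Bool} {d : A} where

  pick-satisfies : ∀ {x xs} → x ∈ₚ xs → T (p x) → T (p (pick p d xs))
  pick-satisfies {xs = y ∷ ys} x∈ px with p y in py
  ... | true = from T-≡ py
  ... | false with x∈
  ...   | here refl    = contradiction (subst T py px) λ ()
  ...   | there x∈ys = pick-satisfies x∈ys px

  pick-cong : ∀ {q : A → Bool} {d′ x xs} → (∀ y → p y ≡ q y) → x ∈ₚ xs → T (p x) → pick p d xs ≡ pick q d′ xs
  pick-cong {q} {xs = y ∷ ys} p≗q x∈ px rewrite p≗q y with q y in qy
  ... | true = refl
  ... | false with x∈
  ...   | here refl    = contradiction (subst T (trans (p≗q y) qy) px) λ ()
  ...   | there x∈ys = pick-cong p≗q x∈ys px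

rep : ∀ {n} → Rel n → Fin n → Fin n
rep {n} R v = pick (R v) v (vs n)

module _ {n} {R : Rel n} (R-equiv : IsEquivalence ⟦ R ⟧) where
  open IsEquivalence R-equiv renaming (refl to R-refl; sym to R-sym; trans to R-trans)

  rep-related : ∀ v → T (R v (rep R v))
  rep-related v = pick-satisfies {p = R v} (∈-allFin v) R-refl

  rep-cong : ∀ {u v} → T (R u v) → rep R u ≡ rep R v
  rep-cong uv = pick-cong (λ w → T-injective (R-trans (R-sym uv)) (R-trans uv)) (∈-allFin _) R-refl

-- The join, over the classes K of R, of the disjoint union of the stable set K ∩ S and
-- the clique K ∖ S.
joinGraph : ∀ {n} → Rel n → Subset n → Graph n
joinGraph R S u v = not (u == v) ∧ (not (R u v) ∨ (not (S u) ∧ not (S v)))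

joinGraph-cong : ∀ {n} {R R′ : Rel n} {S S′ : Subset n} → R ≋ R′ → (∀ u → S u ≡ S′ u) →
                 joinGraph R S ≋ joinGraph R′ S′
joinGraph-cong R≋R′ S≗S′ u v =
  cong (not (u == v) ∧_) (cong₂ _∨_ (cong not (R≋R′ u v)) (cong₂ _∧_ (cong not (S≗S′ u)) (cong not (S≗S′ v))))

module Decomposition {n} {g : Graph n} (g-simple : T (isSimple g))
                     (g-shape : ∀ v → T (stablePlusClique g (compᶜ g v))) where

  g-irrefl : ∀ u → g u u ≡ false
  g-irrefl = proj₁ (isSimple⁻ {g = g} g-simple)

  comp-isEquivalence : IsEquivalence ⟦ sameCompᶜ g ⟧
  comp-isEquivalence = sameCompᶜ-isEquivalence (proj₂ (isSimple⁻ {g = g} g-simple))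

  open IsEquivalence comp-isEquivalence using () renaming (sym to comp-sym; trans to comp-trans)

  stablePart : Fin n → Subset n
  stablePart v = proj₁ (Any.satisfied (any⁻ _ (allSubsets n) (g-shape v)))

  stablePart-split : ∀ v → T (allPairs (compᶜ g v) (λ a b → g a b ⇔ᵇ (not (stablePart v a) ∧ not (stablePart v b))))
  stablePart-split v = proj₂ (Any.satisfied (any⁻ _ (allSubsets n) (g-shape v)))

  -- Reading the split of a component off one representative makes all of its vertices
  -- use the same witness.
  S : Subset n
  S u = stablePart (rep (sameCompᶜ g) u) u

  split-within : ∀ {u v} → T (sameCompᶜ g u v) → u ≢ v → g u v ≡ (not (S u) ∧ not (S v))
  split-within {u} {v} uv u≢v = begin
    g u v
      ≡⟨ T-⇔ᵇ⁻ (allPairs⁻ {K = compᶜ g r} (stablePart-split r) r∼u (comp-trans r∼u uv) u≢v) ⟩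
    not (stablePart r u) ∧ not (stablePart r v)
      ≡⟨ cong (λ r′ → not (stablePart r u) ∧ not (stablePart r′ v)) (rep-cong comp-isEquivalence uv) ⟩
    not (S u) ∧ not (S v)
      ∎
    where
    open ≡-Reasoning
    r : Fin n
    r = rep (sameCompᶜ g) u
    r∼u : T (sameCompᶜ g r u)
    r∼u = comp-sym (rep-related comp-isEquivalence u)

  adjacent-across : ∀ {u v} → u ≢ v → ¬ T (sameCompᶜ g u v) → T (g u v)
  adjacent-across {u} {v} u≢v ¬uv with g u v in guv
  ... | true  = _
  ... | false = contradiction (coAdj⇒sameCompᶜ {u = u} {v} nonadjacent) ¬uv
    where
    nonadjacent : T (coAdj g u v)
    nonadjacent = from T-∧ (fromWitnessFalse u≢v , subst (T ∘ not) (sym guv) _)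

  decomposition : g ≋ joinGraph (sameCompᶜ g) S
  decomposition u v with u ≟ v
  ... | yes refl = g-irrefl u
  ... | no u≢v with sameCompᶜ g u v in uv
  ...   | true  = split-within (from T-≡ uv) u≢v
  ...   | false = T-injective _ λ _ → adjacent-across u≢v (λ uv′ → subst T uv uv′)

f⁴≤2^k*Bell : ∀ k → f⁴ k ≤ 2 ^ k * Bell k
f⁴≤2^k*Bell k = begin
  f⁴ k                                                  ≤⟨ unique-length-≤ (relSetoid k)
                                                             (filter⁺ (relSetoid k) _ (allRels-unique k))
                                                             (All.map decomposed (all-filter _ (allRels k))) ⟩
  length (cartesianProductWith joinGraph equivs (allSubsets k)) ≡⟨ length-cartesianProductWith joinGraph equivs _ ⟩
  Bell k * length (allSubsets k)                        ≡⟨ cong (Bell k *_) (length-allFunsTo bools k) ⟩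
  Bell k * 2 ^ k                                        ≡⟨ *-comm (Bell k) (2 ^ k) ⟩
  2 ^ k * Bell k                                        ∎
  where
  open ≤-Reasoning
  equivs : List (Rel k)
  equivs = filterᵇ isEquivRel (allRels k)

  decomposed : ∀ {g} → T (qualifies stablePlusClique g) →
               [ relSetoid k ] g ∈ cartesianProductWith joinGraph equivs (allSubsets k)
  decomposed {g} g-qualifies with g-simple , g-shape ← to T-∧ g-qualifies =
    ∈-resp-≈ (relSetoid k) (λ u v → sym (decomposition u v))
      (∈-cartesianProductWith⁺ (relSetoid k) (subsetSetoid k) (relSetoid k) joinGraph-cong
        (∈-filter⁺ (relSetoid k) (T? ∘ isEquivRel) (λ r≋s → subst T (isEquivRel-cong r≋s))
          (rel-∈-allRels _) (isEquivRel⁺ comp-isEquivalence))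
        (subset-∈-allSubsets S))
    where open Decomposition {g = g} g-simple (all-vs⁻ g-shape)

-- Each class becomes its representative plus a clique on the other members; in the
-- complement the class is a star centred at the representative.
repGraph : ∀ {n} → Rel n → Graph n
repGraph R = joinGraph R (λ v → v == rep R v)

module _ {n} {R : Rel n} (R-equiv : IsEquivalence ⟦ R ⟧) where
  open IsEquivalence R-equiv renaming (refl to R-refl; sym to R-sym; trans to R-trans)

  joinGraph-within : ∀ {S u w} → T (R u w) → u ≢ w → joinGraph R S u w ≡ (not (S u) ∧ not (S w))
  joinGraph-within {u = u} {w} uw u≢w with u ≟ w
  ... | yes u≡w = contradiction u≡w u≢w
  ... | no _ rewrite to T-≡ uw = refl

  joinGraph-sym : ∀ {S} u v → joinGraph R S u v ≡ joinGraph R S v u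
  joinGraph-sym {S} u v =
    cong₂ _∧_ (cong not (==-sym u v)) (cong₂ _∨_ (cong not (T-injective R-sym R-sym)) (∧-comm (not (S u)) _))

  joinGraph-isSimple : ∀ {S} → T (isSimple (joinGraph R S))
  joinGraph-isSimple {S} = isSimple⁺ {g = joinGraph R S} irreflexive (joinGraph-sym {S})
    where
    irreflexive : ∀ u → joinGraph R S u u ≡ false
    irreflexive u rewrite to T-≡ (≡⇒== {u = u} refl) = refl

  sameCompᶜ-joinGraph⇒R : ∀ {S u v} → T (sameCompᶜ (joinGraph R S) u v) → T (R u v)
  sameCompᶜ-joinGraph⇒R {S} = Star.fold ⟦ R ⟧ (λ uw wv → R-trans (coAdj⇒R {S} uw) wv) R-refl ∘ to sameCompᶜ⇔Star
    where
    coAdj⇒R : ∀ {S u w} → T (coAdj (joinGraph R S) u w) → T (R u w)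
    coAdj⇒R {u = u} {w} uw with u ≟ w | R u w
    ... | _     | true  = _
    ... | yes _ | false = uw
    ... | no _  | false = uw

  private
    S : Subset n
    S v = v == rep R v
    G : Graph n
    G = repGraph R
    module G = IsEquivalence (sameCompᶜ-isEquivalence {g = G} (joinGraph-sym {S}))

  sameCompᶜ-rep : ∀ u → T (sameCompᶜ G u (rep R u))
  sameCompᶜ-rep u with u ≟ rep R u
  ... | yes u≡r = subst (T ∘ sameCompᶜ G u) u≡r G.refl
  ... | no u≢r  = coAdj⇒sameCompᶜ {u = u} (from T-∧ (fromWitnessFalse u≢r , from T-not-≡ nonadjacent))
    where
    nonadjacent : G u (rep R u) ≡ false
    nonadjacent = begin
      G u (rep R u)                                         ≡⟨ joinGraph-within {S} (rep-related R-equiv u) u≢r ⟩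
      not (u == rep R u) ∧ not (rep R u == rep R (rep R u)) ≡⟨ cong (λ b → not (u == rep R u) ∧ not b) rep-is-rep ⟩
      not (u == rep R u) ∧ false                            ≡⟨ ∧-zeroʳ _ ⟩
      false                                                 ∎
      where
      open ≡-Reasoning
      rep-is-rep : (rep R u == rep R (rep R u)) ≡ true
      rep-is-rep = to T-≡ (≡⇒== (rep-cong R-equiv (rep-related R-equiv u)))

  repGraph-components : sameCompᶜ G ≋ R
  repGraph-components u v = T-injective (sameCompᶜ-joinGraph⇒R {S}) λ uv →
    G.trans (sameCompᶜ-rep u)
            (subst (λ r → T (sameCompᶜ G r v)) (sym (rep-cong R-equiv uv)) (G.sym (sameCompᶜ-rep v)))

  repGraph-qualifies : T (qualifies vertexPlusClique G)
  repGraph-qualifies = from T-∧ (joinGraph-isSimple {S} , all-vs⁺ component-shape)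
    where
    component-shape : ∀ v → T (vertexPlusClique G (compᶜ G v))
    component-shape v = any-vs⁺ (rep R v) (from T-∧ (sameCompᶜ-rep v , allPairs⁺ {K = compᶜ G v} clique))
      where
      clique : ∀ {u w} → T (compᶜ G v u) → T (compᶜ G v w) → u ≢ w →
               T (G u w ⇔ᵇ (not (u == rep R v) ∧ not (w == rep R v)))
      clique {u} {w} vu vw u≢w = T-⇔ᵇ⁺ (trans (joinGraph-within {S} (R-trans (R-sym v∼u) v∼w) u≢w)
        (cong₂ (λ a b → not (u == a) ∧ not (w == b)) (rep-cong R-equiv (R-sym v∼u)) (rep-cong R-equiv (R-sym v∼w))))
        where
        v∼u : T (R v u)
        v∼u = sameCompᶜ-joinGraph⇒R {S} vu
        v∼w : T (R v w)
        v∼w = sameCompᶜ-joinGraph⇒R {S} vw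

Bell≤f¹ : ∀ k → Bell k ≤ f¹ k
Bell≤f¹ k = begin
  Bell k                        ≤⟨ unique-length-≤ (relSetoid k)
                                     (filter⁺ (relSetoid k) _ (allRels-unique k))
                                     (All.map realised (all-filter _ (allRels k))) ⟩
  length (map sameCompᶜ graphs) ≡⟨ length-map sameCompᶜ graphs ⟩
  f¹ k                          ∎
  where
  open ≤-Reasoning
  graphs : List (Graph k)
  graphs = filterᵇ (qualifies vertexPlusClique) (allRels k)

  realised : ∀ {R} → T (isEquivRel R) → [ relSetoid k ] R ∈ map sameCompᶜ graphs
  realised {R} R-isEquivRel =
    ∈-resp-≈ (relSetoid k) (repGraph-components R-equiv)
      (∈-map⁺ (relSetoid k) (relSetoid k) sameCompᶜ-cong
        (∈-filter⁺ (relSetoid k) (T? ∘ qualifies vertexPlusClique)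
          (λ g≋h → subst T (qualifies-vertexPlusClique-cong g≋h))
          (rel-∈-allRels (repGraph R)) (repGraph-qualifies R-equiv)))
    where
    R-equiv : IsEquivalence ⟦ R ⟧
    R-equiv = isEquivRel⁻ R-isEquivRel

infix 4 _⊑_
_⊑_ : ∀ {n} → Shape n → Shape n → Set
shape ⊑ shape′ = ∀ g K → T (shape g K) → T (shape′ g K)

⊑-refl : ∀ {n} {shape : Shape n} → shape ⊑ shape
⊑-refl _ _ = id

infixl 6 _∪ˢ_
_∪ˢ_ : ∀ {n} → Shape n → Shape n → Shape n
(shape ∪ˢ shape′) g K = shape g K ∨ shape′ g K

∪ˢ-⊑ : ∀ {n} {shape shape′ shape″ : Shape n} → shape ⊑ shape″ → shape′ ⊑ shape″ → shape ∪ˢ shape′ ⊑ shape″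
∪ˢ-⊑ {shape = shape} shape⊑ shape′⊑ g K = [ shape⊑ g K , shape′⊑ g K ]′ ∘ to (T-∨ {shape g K})

⊑-∪ˢʳ : ∀ {n} {shape shape′ : Shape n} → shape′ ⊑ shape ∪ˢ shape′
⊑-∪ˢʳ _ _ = from T-∨ ∘ inj₂

numGraphs-mono : ∀ {n} {shape shape′ : Shape n} → shape ⊑ shape′ → numGraphs n shape ≤ numGraphs n shape′
numGraphs-mono {n} {shape} {shape′} shape⊑shape′ = countᵇ-mono weaken (allRels n)
  where
  weaken : ∀ {g} → T (qualifies shape g) → T (qualifies shape′ g)
  weaken {g} g-qualifies with g-simple , g-shape ← to (T-∧ {isSimple g}) g-qualifies =
    from T-∧ (g-simple , all-vs⁺ {p = λ v → shape′ g (compᶜ g v)} (shape⊑shape′ g _ ∘ all-vs⁻ g-shape))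

module _ {n} {g : Graph n} {K : Subset n} where

  stablePlusClique⁺ : ∀ S → T (allPairs K (λ u w → g u w ⇔ᵇ (not (S u) ∧ not (S w)))) → T (stablePlusClique g K)
  stablePlusClique⁺ S split =
    any⁺ (λ S′ → allPairs K (λ u w → g u w ⇔ᵇ (not (S′ u) ∧ not (S′ w)))) (Any.map split′ (subset-∈-allSubsets S))
    where
    split′ : ∀ {S′ : Subset n} → (∀ u → S u ≡ S′ u) → T (allPairs K (λ u w → g u w ⇔ᵇ (not (S′ u) ∧ not (S′ w))))
    split′ S≗S′ = allPairs⁺ {K = K} λ {u} {w} Ku Kw u≢w →
      T-⇔ᵇ⁺ (trans (T-⇔ᵇ⁻ (allPairs⁻ {K = K} split Ku Kw u≢w)) (cong₂ (λ a b → not a ∧ not b) (S≗S′ u) (S≗S′ w)))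

vertexPlusClique⊑stablePlusClique : ∀ {n} → vertexPlusClique {n} ⊑ stablePlusClique
vertexPlusClique⊑stablePlusClique g K h with x , Kx∧split ← any-vs⁻ h =
  stablePlusClique⁺ {g = g} {K} (_== x) (proj₂ (to (T-∧ {K x}) Kx∧split))

stableSet⊑stablePlusClique : ∀ {n} → stableSet {n} ⊑ stablePlusClique
stableSet⊑stablePlusClique g K stable = stablePlusClique⁺ {g = g} {K} (λ _ → true)
  (allPairs⁺ {K = K} λ Ku Kw u≢w → T-⇔ᵇ⁺ (to T-not-≡ (allPairs⁻ {K = K} stable Ku Kw u≢w)))

stable3⊑stablePlusClique : ∀ {n} → stable3 {n} ⊑ stablePlusClique
stable3⊑stablePlusClique g K = stableSet⊑stablePlusClique g K ∘ proj₁ ∘ to (T-∧ {stableSet g K})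

Bell≤numGraphs≤2^k*Bell : ∀ k (shape : Shape k) → vertexPlusClique ⊑ shape → shape ⊑ stablePlusClique →
                          Bell k ≤ numGraphs k shape × numGraphs k shape ≤ 2 ^ k * Bell k
Bell≤numGraphs≤2^k*Bell k shape vpc⊑shape shape⊑spc =
    ≤-trans (Bell≤f¹ k) (numGraphs-mono vpc⊑shape)
  , ≤-trans (numGraphs-mono shape⊑spc) (f⁴≤2^k*Bell k)

mainTheorem17 : (k : ℕ) → 1 ≤ k →
    ((Bell k ≤ f¹ k) × (f¹ k ≤ 2 ^ k * Bell k)) ×
    ((Bell k ≤ f² k) × (f² k ≤ 2 ^ k * Bell k)) ×
    ((Bell k ≤ f³ k) × (f³ k ≤ 2 ^ k * Bell k)) ×
    ((Bell k ≤ f⁴ k) × (f⁴ k ≤ 2 ^ k * Bell k))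
-- The bounds also hold for k = 0, where every count is 1.
mainTheorem17 k _ =
    Bell≤numGraphs≤2^k*Bell k vertexPlusClique ⊑-refl vpc⊑spc
  , Bell≤numGraphs≤2^k*Bell k (stable3 ∪ˢ vertexPlusClique) ⊑-∪ˢʳ (∪ˢ-⊑ stable3⊑stablePlusClique vpc⊑spc)
  , Bell≤numGraphs≤2^k*Bell k (stableSet ∪ˢ vertexPlusClique) ⊑-∪ˢʳ (∪ˢ-⊑ stableSet⊑stablePlusClique vpc⊑spc)
  , Bell≤numGraphs≤2^k*Bell k stablePlusClique vpc⊑spc ⊑-refl
  where
  vpc⊑spc : vertexPlusClique {k} ⊑ stablePlusClique
  vpc⊑spc = vertexPlusClique⊑stablePlusClique
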